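{- Let $\mathbf P=(P,\leq,{}',0,1)$ be an orthomodular poset of finite height, and for $x,y\in P$ put $x\rightarrow y:=y\vee\operatorname{Max}L(x',y')\subseteq P$. Then for all $x,y\in P$: (i) $x\rightarrow0=x'$; (ii) $x\leq y$ if and only if $x\rightarrow y=1$; (iii) $x\rightarrow x'=x'$; (iv) if $x\perp y$, then $(x\vee y)'\vee y$ exists and $x\rightarrow y=(x\vee y)'\vee y$; (v) if $x\perp y$, then $x\vee y=(x\rightarrow y)\rightarrow y$; (vi) if $x\perp y$, then $x\vee y=x'\rightarrow y$; (vii) if $x\geq y$, then $x\rightarrow y=x'\vee y$; (viii) if $x\perp y$, then $((x\rightarrow y)\rightarrow y)\rightarrow y=x\rightarrow y$; (ix) if $x\leq y$, then $(((y'\rightarrow x)\rightarrow x)'\rightarrow x)\rightarrow x=y$; (x) $(x'\rightarrow x)\rightarrow x=1$; (xi) $x\rightarrow(y\rightarrow x)=1$.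
   Context: A bounded poset $(P,\leq,0,1)$ is a poset with least element $0$ and greatest element $1$; it has finite height if every chain is finite. A unary operation $'$ is an antitone involution if $x\leq y$ implies $y'\leq x'$ and $x''=x$; write $x\perp y$ (orthogonal) if $x\leq y'$. An orthomodular poset is $(P,\leq,{}',0,1)$ where $(P,\leq,0,1)$ is a bounded poset, $'$ is an antitone involution, for all $x\perp y$ the supremum $x\vee y$ exists, $x\vee x'=1$ and $x\wedge x'=0$ for all $x$, and the orthomodular law holds: $x\leq y$ implies $(y'\vee x)'\vee x=y$. For $A\subseteq P$: $L(A)=\{x\in P\mid x\leq a\text{ for all }a\in A\}$, $L(a,b)=L(\{a,b\})$; $\operatorname{Max}A$ is the set of maximal elements of $A$; $a\vee A=\{a\vee x\mid x\in A\}$ (these joins exist in the definition of $x\rightarrow y$ since every element of $L(x',y')$ is orthogonal to $y$). Thus $x\rightarrow y$ is a nonempty subset of $P$. Singletons are identified with the element they contain (so e.g. $x\rightarrow y=1$ means $x\rightarrow y=\{1\}$, and a singleton set may be used as an argument of $\rightarrow$). For subsets $A,B\subseteq P$, convention (G): $A\rightarrow B=1$ means that for every $a\in A$ there exists $b\in B$ with $a\rightarrow b=1$. -}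

module Defs where

open import Level using (Level; _⊔_) renaming (suc to lsuc)
open import Data.Product using (Σ; _×_; _,_; ∃)
open import Data.Sum using (_⊎_)
open import Data.List using (List)
open import Data.List.Membership.Propositional using (_∈_)
open import Relation.Binary.PropositionalEquality using (_≡_)
open import Relation.Binary.Structures using (IsPartialOrder)
open import Relation.Unary using (Pred; ｛_｝; _≐_)

-- Orthomodular posets. Equality is propositional equality on the carrier.
-- Suprema/infima are treated relationally (they need not exist in general).
record OMP (a : Level) : Set (lsuc a) where
  infix 4 _≤_ _⊥_
  field
    Carrier : Set a
    _≤_     : Carrier → Carrier → Set a
    _′      : Carrier → Carrier
    𝟎 𝟏     : Carrier

  IsSup : Carrier → Carrier → Carrier → Set a
  IsSup x y s = (x ≤ s) × (y ≤ s) × (∀ u → x ≤ u → y ≤ u → s ≤ u)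

  IsInf : Carrier → Carrier → Carrier → Set a
  IsInf x y i = (i ≤ x) × (i ≤ y) × (∀ u → u ≤ x → u ≤ y → u ≤ i)

  _⊥_ : Carrier → Carrier → Set a
  x ⊥ y = x ≤ (y ′)

  field
    isPartialOrder : IsPartialOrder _≡_ _≤_
    bottom         : ∀ x → 𝟎 ≤ x
    top            : ∀ x → x ≤ 𝟏
    antitone       : ∀ {x y} → x ≤ y → (y ′) ≤ (x ′)
    involutive     : ∀ x → ((x ′) ′) ≡ x
    join-orth      : ∀ x y → x ⊥ y → ∃ λ s → IsSup x y s
    compl-join     : ∀ x → IsSup x (x ′) 𝟏
    compl-meet     : ∀ x → IsInf x (x ′) 𝟎
    -- orthomodular law: x ≤ y implies (y' ∨ x)' ∨ x = y
    orthomodular   : ∀ x y → x ≤ y → ∀ s → IsSup (y ′) x s → IsSup (s ′) x y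

module Ops {a : Level} (O : OMP a) where
  open OMP O

  IsChain : Pred Carrier a → Set a
  IsChain C = ∀ x y → C x → C y → (x ≤ y) ⊎ (y ≤ x)

  IsFinite : Pred Carrier a → Set a
  IsFinite C = Σ (List Carrier) λ xs → ∀ x → C x → x ∈ xs

  FiniteHeight : Set (lsuc a)
  FiniteHeight = ∀ (C : Pred Carrier a) → IsChain C → IsFinite C

  L : Carrier → Carrier → Pred Carrier a
  L x y z = (z ≤ x) × (z ≤ y)

  Max : Pred Carrier a → Pred Carrier a
  Max A z = A z × (∀ w → A w → z ≤ w → w ≡ z)

  _∨ₛ_ : Carrier → Pred Carrier a → Pred Carrier a
  (b ∨ₛ A) z = ∃ λ m → A m × IsSup b m z

  infixr 5 _⇒_ _⇒ₛ_
  _⇒_ : Carrier → Carrier → Pred Carrier a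
  x ⇒ y = y ∨ₛ Max (L (x ′) (y ′))

  -- extension of → to a subset as first argument: A → y = ⋃_{a ∈ A} (a → y)
  -- (for a singleton A = {a} this is a → y)
  _⇒ₛ_ : Pred Carrier a → Carrier → Pred Carrier a
  (A ⇒ₛ y) z = ∃ λ x → A x × (x ⇒ y) z

  _ᶜ : Pred Carrier a → Pred Carrier a
  (A ᶜ) z = ∃ λ x → A x × (z ≡ (x ′))

  -- convention (G): A → B = 1 iff for every a ∈ A there is b ∈ B with a → b = 1
  ⇒G≡𝟏 : Pred Carrier a → Pred Carrier a → Set a
  ⇒G≡𝟏 A B = ∀ x → A x → ∃ λ b → B b × ((x ⇒ b) ≐ ｛ 𝟏 ｝)

-- In every case of (i)–(x) the lower cone L(x', y') turns out to have a greatest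
-- element c (x', y', 0 or (x ∨ y)'), so Max L(x', y') = {c} and x → y is the single
-- join y ∨ c; the identities then reduce to orthomodularity and uniqueness of joins.
-- Finite height enters only in (xi): with excluded middle it makes Max L(y', x')
-- nonempty, and for m in it x ∨ m ∈ y → x lies above x, so x → (x ∨ m) = 1 by (ii).
module Submission where

open import Defs
open import Level using (Level)
open import Axiom.ExcludedMiddle using (ExcludedMiddle)
open import Data.Empty using (⊥-elim) renaming (⊥ to Empty)
open import Data.Fin using (Fin; toℕ)
open import Data.Fin.Properties using (pigeonhole)
open import Data.List using (length; lookup)
open import Data.List.Relation.Unary.Any using (index)
open import Data.List.Relation.Unary.Any.Properties using (lookup-index)
open import Data.Nat as ℕ using (ℕ; suc; _≤′_; ≤′-reflexive; ≤′-step)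
open import Data.Nat.Properties using (≤-total; ≤⇒≤′; n<1+n)
open import Data.Product using (Σ; _×_; ∃; _,_; proj₁; proj₂)
open import Data.Sum using (inj₁; inj₂)
open import Function using (case_of_)
open import Relation.Binary.PropositionalEquality using (_≡_; refl; sym; trans; subst; cong)
open import Relation.Binary.Structures using (IsPartialOrder)
open import Relation.Nullary using (yes; no; ¬_)
open import Relation.Unary using (Pred; ｛_｝; _≐_)
open import Relation.Unary.Properties using (≐-sym; ≐-trans)

module OrthomodularPosetProperties {a : Level} (O : OMP a) where
  open OMP O
  open Ops O
  open IsPartialOrder isPartialOrder using (antisym) renaming (refl to ≤-refl; trans to ≤-trans)

  ⊥-sym : ∀ {p q} → p ⊥ q → q ⊥ p
  ⊥-sym {p} {q} p⊥q = subst (_≤ p ′) (involutive q) (antitone p⊥q)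

  ≤-′′ : ∀ x → x ≤ (x ′) ′
  ≤-′′ x = subst (x ≤_) (sym (involutive x)) ≤-refl

  ′′-≤ : ∀ x → (x ′) ′ ≤ x
  ′′-≤ x = subst (_≤ x) (sym (involutive x)) ≤-refl

  𝟏′-least : ∀ x → 𝟏 ′ ≤ x
  𝟏′-least x = ≤-trans (antitone (top (x ′))) (′′-≤ x)

  IsSup-unique : ∀ {p q s t} → IsSup p q s → IsSup p q t → s ≡ t
  IsSup-unique (p≤s , q≤s , s-least) (p≤t , q≤t , t-least) =
    antisym (s-least _ p≤t q≤t) (t-least _ p≤s q≤s)

  IsSup-comm : ∀ {p q s} → IsSup p q s → IsSup q p s
  IsSup-comm (p≤s , q≤s , s-least) = q≤s , p≤s , λ u q≤u p≤u → s-least u p≤u q≤u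

  ⊥-IsSup : ∀ {p q s} → IsSup p q s → ∀ {z} → z ⊥ p → z ⊥ q → z ⊥ s
  ⊥-IsSup (_ , _ , s-least) z⊥p z⊥q = ⊥-sym (s-least _ (⊥-sym z⊥p) (⊥-sym z⊥q))

  Max-greatest : ∀ {A : Pred Carrier a} {c} → A c → (∀ z → A z → z ≤ c) → Max A ≐ ｛ c ｝
  Max-greatest {c = c} Ac greatest =
    (λ { (Az , maximal) → maximal c Ac (greatest _ Az) }) ,
    λ { refl → Ac , λ w Aw c≤w → antisym (greatest w Aw) c≤w }

  ⇒-greatest : ∀ {x y c t} → L (x ′) (y ′) c → (∀ z → L (x ′) (y ′) z → z ≤ c) →
               IsSup y c t → (x ⇒ y) ≐ ｛ t ｝
  ⇒-greatest Lc greatest y∨c≡t =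
    (λ { (m , Max-m , y∨m≡u) →
           IsSup-unique y∨c≡t (subst (λ k → IsSup _ k _) (sym (proj₁ (Max-greatest Lc greatest) Max-m)) y∨m≡u) }) ,
    λ { refl → _ , proj₂ (Max-greatest Lc greatest) refl , y∨c≡t }

  ⇒ₛ-cong : ∀ {A B : Pred Carrier a} y → A ≐ B → (A ⇒ₛ y) ≐ (B ⇒ₛ y)
  ⇒ₛ-cong y (A⊆B , B⊆A) = (λ { (w , Aw , r) → w , A⊆B Aw , r }) , λ { (w , Bw , r) → w , B⊆A Bw , r }

  ⇒ₛ-singleton : ∀ w y → (｛ w ｝ ⇒ₛ y) ≐ (w ⇒ y)
  ⇒ₛ-singleton w y = (λ { (_ , refl , r) → r }) , λ r → w , refl , r

  ᶜ-singleton : ∀ {A : Pred Carrier a} {w} → A ≐ ｛ w ｝ → (A ᶜ) ≐ ｛ w ′ ｝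
  ᶜ-singleton {w = w} (A⊆w , w⊆A) = (λ { (_ , Av , refl) → cong _′ (A⊆w Av) }) , λ { refl → w , w⊆A refl , refl }

  ⇒-𝟎 : ∀ x → (x ⇒ 𝟎) ≐ ｛ x ′ ｝
  ⇒-𝟎 x = ⇒-greatest (≤-refl , ⊥-sym (bottom _)) (λ _ → proj₁) (bottom _ , ≤-refl , λ _ _ h → h)

  ⇒≐𝟏-intro : ∀ {x y} → x ≤ y → (x ⇒ y) ≐ ｛ 𝟏 ｝
  ⇒≐𝟏-intro x≤y = ⇒-greatest (antitone x≤y , ≤-refl) (λ _ → proj₂) (compl-join _)

  -- If y ∨ m = 1 with m ≤ y', orthomodularity applied to y ≤ m' gives m' = 1' ∨ y = y.
  ⇒≐𝟏-elim : ∀ {x y} → (x ⇒ y) ≐ ｛ 𝟏 ｝ → x ≤ y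
  ⇒≐𝟏-elim {x} {y} (_ , 𝟏∈x⇒y) with 𝟏∈x⇒y refl
  ... | m , ((m≤x′ , m≤y′) , _) , y∨m≡𝟏 = subst (x ≤_) m′≡y (⊥-sym m≤x′)
    where
      m′′∨y≡𝟏 : IsSup ((m ′) ′) y 𝟏
      m′′∨y≡𝟏 = subst (λ k → IsSup k y 𝟏) (sym (involutive m)) (IsSup-comm y∨m≡𝟏)
      m′≡y : m ′ ≡ y
      m′≡y = IsSup-unique (orthomodular y (m ′) (⊥-sym m≤y′) 𝟏 m′′∨y≡𝟏)
                          (𝟏′-least y , ≤-refl , λ _ _ h → h)

  ⇒-′ : ∀ x → (x ⇒ x ′) ≐ ｛ x ′ ｝
  ⇒-′ x = ⇒-greatest (bottom _ , bottom _)
            (λ z (z≤x′ , z≤x′′) → proj₂ (proj₂ (compl-meet x)) z (≤-trans z≤x′′ (′′-≤ x)) z≤x′)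
            (≤-refl , bottom _ , λ _ h _ → h)

  ⇒-⊥ : ∀ {x y} → x ⊥ y → ∀ {s} → IsSup x y s →
        Σ Carrier λ t → IsSup (s ′) y t × ((x ⇒ y) ≐ ｛ t ｝)
  ⇒-⊥ {x} {y} _ {s} x∨y≡s@(x≤s , y≤s , _) with join-orth (s ′) y (antitone y≤s)
  ... | t , s′∨y≡t =
    t , s′∨y≡t ,
    ⇒-greatest (antitone x≤s , antitone y≤s) (λ _ (z⊥x , z⊥y) → ⊥-IsSup x∨y≡s z⊥x z⊥y) (IsSup-comm s′∨y≡t)

  -- With t = (x ∨ y)' ∨ y, orthomodularity for y ≤ x ∨ y reads t' ∨ y = x ∨ y.
  ⇒⇒-⊥ : ∀ {x y} → x ⊥ y → ∀ {s} → IsSup x y s → ((x ⇒ y) ⇒ₛ y) ≐ ｛ s ｝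
  ⇒⇒-⊥ {x} {y} x⊥y {s} x∨y≡s@(_ , y≤s , _) with ⇒-⊥ x⊥y x∨y≡s
  ... | t , s′∨y≡t@(_ , y≤t , _) , x⇒y≡t =
    ≐-trans (⇒ₛ-cong y x⇒y≡t) (≐-trans (⇒ₛ-singleton t y)
      (⇒-greatest (≤-refl , antitone y≤t) (λ _ → proj₁)
                  (IsSup-comm (orthomodular y s y≤s t s′∨y≡t))))

  ′⇒-⊥ : ∀ {x y} → x ⊥ y → ∀ {s} → IsSup x y s → (x ′ ⇒ y) ≐ ｛ s ｝
  ′⇒-⊥ {x} x⊥y x∨y≡s =
    ⇒-greatest (≤-′′ x , x⊥y) (λ z (z≤x′′ , _) → ≤-trans z≤x′′ (′′-≤ x)) (IsSup-comm x∨y≡s)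

  ⇒-≥ : ∀ {x y} → y ≤ x → ∀ {s} → IsSup (x ′) y s → (x ⇒ y) ≐ ｛ s ｝
  ⇒-≥ y≤x x′∨y≡s = ⇒-greatest (≤-refl , antitone y≤x) (λ _ → proj₁) (IsSup-comm x′∨y≡s)

  ⇒⇒⇒-⊥ : ∀ {x y} → x ⊥ y → (((x ⇒ y) ⇒ₛ y) ⇒ₛ y) ≐ (x ⇒ y)
  ⇒⇒⇒-⊥ {x} {y} x⊥y with join-orth x y x⊥y
  ... | s , x∨y≡s@(_ , y≤s , _) with ⇒-⊥ x⊥y x∨y≡s
  ... | t , s′∨y≡t , x⇒y≡t =
    ≐-trans (⇒ₛ-cong y (⇒⇒-⊥ x⊥y x∨y≡s))
      (≐-trans (⇒ₛ-singleton s y) (≐-trans (⇒-≥ y≤s s′∨y≡t) (≐-sym x⇒y≡t)))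

  ′⇒⇒ᶜ⇒⇒-≤ : ∀ {x y} → x ≤ y → (((((y ′) ⇒ x) ⇒ₛ x) ᶜ ⇒ₛ x) ⇒ₛ x) ≐ ｛ y ｝
  ′⇒⇒ᶜ⇒⇒-≤ {x} {y} x≤y with join-orth (y ′) x (antitone x≤y)
  ... | s , y′∨x≡s@(_ , x≤s , _) =
    ≐-trans (⇒ₛ-cong x (≐-trans (⇒ₛ-cong x (ᶜ-singleton (⇒⇒-⊥ (antitone x≤y) y′∨x≡s)))
                                (⇒ₛ-singleton (s ′) x)))
            (⇒⇒-⊥ (antitone x≤s) (orthomodular x y x≤y s y′∨x≡s))

  ′⇒⇒ : ∀ x → (((x ′) ⇒ x) ⇒ₛ x) ≐ ｛ 𝟏 ｝
  ′⇒⇒ x = ⇒⇒-⊥ ≤-refl (IsSup-comm (compl-join x))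

module FiniteHeightProperties {a : Level} (O : OMP a) (fh : Ops.FiniteHeight O) where
  open OMP O
  open Ops O
  open IsPartialOrder isPartialOrder using (antisym; reflexive) renaming (refl to ≤-refl; trans to ≤-trans)
  open OrthomodularPosetProperties O using (⊥-sym; ⇒≐𝟏-intro)

  StrictlyAbove : Carrier → Carrier → Set a
  StrictlyAbove z w = z ≤ w × ¬ (w ≡ z)

  module _ (g : ℕ → Carrier) (ascending : ∀ n → StrictlyAbove (g n) (g (suc n))) where

    private
      range : Pred Carrier a
      range z = ∃ λ n → g n ≡ z

      monotone : ∀ {n m} → n ≤′ m → g n ≤ g m
      monotone (≤′-reflexive refl) = ≤-refl
      monotone (≤′-step n≤′m) = ≤-trans (monotone n≤′m) (proj₁ (ascending _))

      range-chain : IsChain range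
      range-chain _ _ (n , refl) (m , refl) with ≤-total n m
      ... | inj₁ n≤m = inj₁ (monotone (≤⇒≤′ n≤m))
      ... | inj₂ m≤n = inj₂ (monotone (≤⇒≤′ m≤n))

      no-repetition : ∀ {n m} → n ℕ.< m → ¬ (g n ≡ g m)
      no-repetition n<m gn≡gm =
        proj₂ (ascending _) (antisym (≤-trans (monotone (≤⇒≤′ n<m)) (reflexive (sym gn≡gm)))
                                     (proj₁ (ascending _)))

      range-not-finite : ¬ IsFinite range
      range-not-finite (xs , g∈xs) =
        case pigeonhole (n<1+n (length xs)) (λ i → position (toℕ i)) of λ where
          (i , j , i<j , same-position) →
            no-repetition i<j (trans (lookup-position (toℕ i))
                                     (trans (cong (lookup xs) same-position) (sym (lookup-position (toℕ j)))))
        where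
          position : ℕ → Fin (length xs)
          position n = index (g∈xs (g n) (n , refl))

          lookup-position : ∀ n → g n ≡ lookup xs (position n)
          lookup-position n = lookup-index (g∈xs (g n) (n , refl))

    no-strictly-ascending-sequence : Empty
    no-strictly-ascending-sequence = range-not-finite (fh range range-chain)

  module _ (em : ExcludedMiddle a) where

    -- Without maximal elements every point of A steps strictly up inside A; iterating
    -- from z₀ gives a strictly ascending sequence, which finite height forbids.
    Max-nonempty : ∀ {A : Pred Carrier a} {z₀} → A z₀ → Σ Carrier (Max A)
    Max-nonempty {A} {z₀} Az₀ with em {Σ Carrier (Max A)}
    ... | yes max = max
    ... | no ¬max = ⊥-elim (no-strictly-ascending-sequence (λ n → proj₁ (ascent n)) (λ n → proj₂ (proj₂ (step (ascent n)))))
      where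
        step : (z : Σ Carrier A) → Σ Carrier λ w → A w × StrictlyAbove (proj₁ z) w
        step (z , Az) with em {Σ Carrier λ w → A w × StrictlyAbove z w}
        ... | yes above = above
        ... | no ¬above = ⊥-elim (¬max (z , Az , maximal))
          where
            maximal : ∀ w → A w → z ≤ w → w ≡ z
            maximal w Aw z≤w with em {w ≡ z}
            ... | yes w≡z = w≡z
            ... | no w≢z = ⊥-elim (¬above (w , Aw , z≤w , w≢z))

        ascent : ℕ → Σ Carrier A
        ascent ℕ.zero = z₀ , Az₀
        ascent (suc n) with w , Aw , _ ← step (ascent n) = w , Aw

    ⇒-weaken : ∀ x y → ⇒G≡𝟏 ｛ x ｝ (y ⇒ x)
    ⇒-weaken x y .x refl with Max-nonempty {L (y ′) (x ′)} (bottom _ , bottom _)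
    ... | m , Max-m@((_ , m⊥x) , _) with join-orth x m (⊥-sym m⊥x)
    ... | b , x∨m≡b@(x≤b , _ , _) = b , (m , Max-m , x∨m≡b) , ⇒≐𝟏-intro x≤b

proposition2p2 : ∀ {a : Level} → ExcludedMiddle a → (O : OMP a) →
    let open OMP O
        open Ops O
    in FiniteHeight → ∀ x y →
      -- (i)
      ((x ⇒ 𝟎) ≐ ｛ x ′ ｝)
      -- (ii)
      × ((x ≤ y → (x ⇒ y) ≐ ｛ 𝟏 ｝) × ((x ⇒ y) ≐ ｛ 𝟏 ｝ → x ≤ y))
      -- (iii)
      × ((x ⇒ (x ′)) ≐ ｛ x ′ ｝)
      -- (iv)
      × (x ⊥ y → ∀ s → IsSup x y s → Σ Carrier λ t → IsSup (s ′) y t × ((x ⇒ y) ≐ ｛ t ｝))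
      -- (v)
      × (x ⊥ y → ∀ s → IsSup x y s → ((x ⇒ y) ⇒ₛ y) ≐ ｛ s ｝)
      -- (vi)
      × (x ⊥ y → ∀ s → IsSup x y s → ((x ′) ⇒ y) ≐ ｛ s ｝)
      -- (vii)
      × (y ≤ x → ∀ s → IsSup (x ′) y s → (x ⇒ y) ≐ ｛ s ｝)
      -- (viii)
      × (x ⊥ y → (((x ⇒ y) ⇒ₛ y) ⇒ₛ y) ≐ (x ⇒ y))
      -- (ix)
      × (x ≤ y → (((((y ′) ⇒ x) ⇒ₛ x) ᶜ ⇒ₛ x) ⇒ₛ x) ≐ ｛ y ｝)
      -- (x)
      × ((((x ′) ⇒ x) ⇒ₛ x) ≐ ｛ 𝟏 ｝)
      -- (xi)
      × ⇒G≡𝟏 ｛ x ｝ (y ⇒ x)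
proposition2p2 em O fh x y =
  ⇒-𝟎 x ,
  (⇒≐𝟏-intro , ⇒≐𝟏-elim) ,
  ⇒-′ x ,
  (λ x⊥y _ → ⇒-⊥ x⊥y) ,
  (λ x⊥y _ → ⇒⇒-⊥ x⊥y) ,
  (λ x⊥y _ → ′⇒-⊥ x⊥y) ,
  (λ y≤x _ → ⇒-≥ y≤x) ,
  ⇒⇒⇒-⊥ ,
  ′⇒⇒ᶜ⇒⇒-≤ ,
  ′⇒⇒ x ,
  FiniteHeightProperties.⇒-weaken O fh em x y
  where open OrthomodularPosetProperties O
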